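{- For every Kripke structure $\mathcal{K}$, every closed $H_\mu$ formula $\varphi$ in positive normal form and all $k,k'\in\mathbb{N}_0\cup\{\infty\}$ with $k\le k'$: if $\mathcal{K}\models_k\varphi$ then $\mathcal{K}\models_{k'}\varphi$.
   Context: Let $\mathrm{AP}$ be a finite set of atomic propositions. A Kripke structure is $\mathcal{K}=(S,s_0,\delta,L)$ with finite $S$, initial state $s_0$, total transition relation $\delta\subseteq S\times S$ (every state has a successor) and labelling $L:S\to 2^{\mathrm{AP}}$; $\mathrm{Paths}(\mathcal{K})$ is the set of infinite sequences $s_0s_1\dots$ starting in $s_0$ with $(s_i,s_{i+1})\in\delta$. $H_\mu$ formulas: $\varphi::=\exists\pi.\varphi\mid\forall\pi.\varphi\mid\psi$, $\psi::=a_\pi\mid X\mid\bigcirc_\pi\psi\mid\psi\vee\psi\mid\neg\psi\mid\mu X.\psi$ ($a\in\mathrm{AP}$, $\pi$ a path variable, $X$ a predicate variable), with abbreviations $\psi\wedge\psi'\equiv\neg(\neg\psi\vee\neg\psi')$ and $\nu X.\psi\equiv\neg\mu X.\neg\psi[\neg X/X]$; in $\mu X.\psi$, $X$ occurs only under an even number of negations. A formula is closed if all path variables and predicates are bound; it is in positive normal form if $\neg$ occurs only directly in front of atomic propositions (using $\wedge,\nu$) and bound predicates and path variables are pairwise distinct. Semantics: for quantifier-free $\psi$ over path variables $\pi_1,\dots,\pi_n$, a path assignment $\Pi$ maps each $\pi_i$ to a path, and a predicate valuation $\mathcal{V}$ maps predicates to functions from path assignments to subsets of $\mathbb{N}_0^n$.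 For $k\in\mathbb{N}_0\cup\{\infty\}$ let $G_k^n=\{(j_1,\dots,j_n)\in\mathbb{N}_0^n:|j_i-j_{i'}|\le k\ \forall i,i'\}$ ($G_\infty^n=\mathbb{N}_0^n$). Define $[\![a_{\pi_i}]\!]_k^{\mathcal{V}}(\Pi)=\{j\in G_k^n: a\in L(\Pi(\pi_i)(j_i))\}$; $[\![X]\!]_k^{\mathcal{V}}=\mathcal{V}(X)$; $[\![\bigcirc_{\pi_i}\psi]\!]_k^{\mathcal{V}}(\Pi)=\{j\in G_k^n: j+e_i\in[\![\psi]\!]_k^{\mathcal{V}}(\Pi)\}$ ($e_i$ the $i$-th unit vector); $\vee$ is union; $[\![\neg\psi]\!]_k^{\mathcal{V}}(\Pi)=G_k^n\setminus[\![\psi]\!]_k^{\mathcal{V}}(\Pi)$; $[\![\mu X.\psi]\!]_k^{\mathcal{V}}$ is the least $\xi$ (w.r.t. pointwise inclusion of functions from path assignments to $2^{G_k^n}$) with $\xi\supseteq[\![\psi]\!]_k^{\mathcal{V}[X\mapsto\xi]}$. Quantified formulas: $\Pi\models_k\exists\pi.\varphi$ iff $\Pi[\pi\mapsto p]\models_k\varphi$ for some $p\in\mathrm{Paths}(\mathcal{K})$; $\Pi\models_k\forall\pi.\varphi$ iff this holds for all $p$; $\Pi\models_k\psi$ iff $(0,\dots,0)\in[\![\psi]\!]_k^{\mathcal{V}}(\Pi)$ for some $\mathcal{V}$. $\mathcal{K}\models_k\varphi$ iff the empty assignment satisfies $\varphi$. -}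

module Defs where

open import Level using (Level; 0ℓ; Lift) renaming (suc to lsuc)
open import Data.Nat using (ℕ; zero; suc; _≤_; ∣_-_∣)
open import Data.Fin using (Fin; zero; suc; _≟_)
open import Data.Fin.Subset using (Subset; _∈_)
open import Data.Vec.Functional using (Vector; updateAt; _∷_; [])
open import Data.Product using (Σ; ∃; _×_; _,_)
open import Data.Sum using (_⊎_)
open import Data.Unit using (⊤)
open import Data.Empty using (⊥)
open import Relation.Nullary using (¬_; yes; no)
open import Relation.Binary.PropositionalEquality using (_≡_)

record Kripke (nAP : ℕ) : Set₁ where
  field
    nS    : ℕ
    s₀    : Fin nS
    δ     : Fin nS → Fin nS → Set
    total : ∀ s → ∃ λ t → δ s t
    L     : Fin nS → Subset nAP

module _ {nAP : ℕ} (K : Kripke nAP) where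
  open Kripke K

  record Path : Set where
    field
      seq   : ℕ → Fin nS
      start : seq 0 ≡ s₀
      step  : ∀ i → δ (seq i) (seq (suc i))

data ℕ∞ : Set where
  fin : ℕ → ℕ∞
  ∞   : ℕ∞

data _≤∞_ : ℕ∞ → ℕ∞ → Set where
  fin≤fin : ∀ {a b} → a ≤ b → fin a ≤∞ fin b
  ≤∞-∞    : ∀ {k} → k ≤∞ ∞

G : ℕ∞ → {n : ℕ} → (Fin n → ℕ) → Set
G (fin k) j = ∀ i i′ → ∣ j i - j i′ ∣ ≤ k
G ∞       j = ⊤

_+e_ : {n : ℕ} → (Fin n → ℕ) → Fin n → (Fin n → ℕ)
j +e i = updateAt j i suc

-- Syntax of quantifier-free H_μ formulas (de Bruijn):
-- n path variables, m free predicate variables.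

data QF (nAP : ℕ) (n : ℕ) : ℕ → Set where
  atom : ∀ {m} → Fin nAP → Fin n → QF nAP n m
  var  : ∀ {m} → Fin m → QF nAP n m
  next : ∀ {m} → Fin n → QF nAP n m → QF nAP n m
  _∨′_ : ∀ {m} → QF nAP n m → QF nAP n m → QF nAP n m
  neg  : ∀ {m} → QF nAP n m → QF nAP n m
  mu   : ∀ {m} → QF nAP n (suc m) → QF nAP n m       -- μX.ψ (X = var zero)

-- H_μ formulas with n free path variables (quantifier prefix, then a
-- quantifier-free formula with all predicates bound)
data HForm (nAP : ℕ) : ℕ → Set where
  ex  : ∀ {n} → HForm nAP (suc n) → HForm nAP n      -- ∃π.φ (π = path var zero)
  all : ∀ {n} → HForm nAP (suc n) → HForm nAP n
  qf  : ∀ {n} → QF nAP n 0 → HForm nAP n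

_∧′_ : ∀ {nAP n m} → QF nAP n m → QF nAP n m → QF nAP n m
ψ ∧′ ψ′ = neg (neg ψ ∨′ neg ψ′)

negAt : ∀ {nAP n m} → Fin m → QF nAP n m → QF nAP n m
negAt x (atom a i) = atom a i
negAt x (var y) with x ≟ y
... | yes _ = neg (var y)
... | no  _ = var y
negAt x (next i ψ) = next i (negAt x ψ)
negAt x (ψ ∨′ ψ′) = negAt x ψ ∨′ negAt x ψ′
negAt x (neg ψ) = neg (negAt x ψ)
negAt x (mu ψ) = mu (negAt (suc x) ψ)

nu : ∀ {nAP n m} → QF nAP n (suc m) → QF nAP n m
nu ψ = neg (mu (neg (negAt zero ψ)))

data PNF (nAP : ℕ) (n : ℕ) : ℕ → Set where
  atom  : ∀ {m} → Fin nAP → Fin n → PNF nAP n m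
  natom : ∀ {m} → Fin nAP → Fin n → PNF nAP n m
  var   : ∀ {m} → Fin m → PNF nAP n m
  next  : ∀ {m} → Fin n → PNF nAP n m → PNF nAP n m
  or    : ∀ {m} → PNF nAP n m → PNF nAP n m → PNF nAP n m
  and   : ∀ {m} → PNF nAP n m → PNF nAP n m → PNF nAP n m
  μ′    : ∀ {m} → PNF nAP n (suc m) → PNF nAP n m
  ν′    : ∀ {m} → PNF nAP n (suc m) → PNF nAP n m

⌊_⌋ : ∀ {nAP n m} → PNF nAP n m → QF nAP n m
⌊ atom a i ⌋  = atom a i
⌊ natom a i ⌋ = neg (atom a i)
⌊ var x ⌋     = var x
⌊ next i ψ ⌋  = next i ⌊ ψ ⌋
⌊ or ψ ψ′ ⌋   = ⌊ ψ ⌋ ∨′ ⌊ ψ′ ⌋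
⌊ and ψ ψ′ ⌋  = ⌊ ψ ⌋ ∧′ ⌊ ψ′ ⌋
⌊ μ′ ψ ⌋      = mu ⌊ ψ ⌋
⌊ ν′ ψ ⌋      = nu ⌊ ψ ⌋

data HPNF (nAP : ℕ) : ℕ → Set where
  ex  : ∀ {n} → HPNF nAP (suc n) → HPNF nAP n
  all : ∀ {n} → HPNF nAP (suc n) → HPNF nAP n
  qf  : ∀ {n} → PNF nAP n 0 → HPNF nAP n

⌊_⌋H : ∀ {nAP n} → HPNF nAP n → HForm nAP n
⌊ ex φ ⌋H  = ex ⌊ φ ⌋H
⌊ all φ ⌋H = all ⌊ φ ⌋H
⌊ qf ψ ⌋H  = qf ⌊ ψ ⌋

module Semantics {nAP : ℕ} (K : Kripke nAP) where
  open Kripke K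
  open Path

  Assign : ℕ → Set
  Assign n = Vector (Path K) n

  PredVal : ℕ → Set₁
  PredVal n = Assign n → (Fin n → ℕ) → Set

  Valuation : ℕ → ℕ → Set₁
  Valuation n m = Fin m → PredVal n

  -- ⟦ψ⟧_k^V(Π) as a predicate on index vectors.
  -- μX.ψ is the least ξ ⊆ G_k^n (pointwise) with ξ ⊇ ⟦ψ⟧^{V[X↦ξ]},
  -- i.e. the intersection of all such pre-fixed points.
  ⟦_⟧ : ∀ {n m} → QF nAP n m → ℕ∞ → Valuation n m → Assign n → (Fin n → ℕ) → Set₁
  ⟦ atom a i ⟧ k V Π j = Lift (lsuc 0ℓ) (G k j) × Lift (lsuc 0ℓ) (a ∈ L (seq (Π i) (j i)))
  ⟦ var x ⟧    k V Π j = Lift (lsuc 0ℓ) (V x Π j)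
  ⟦ next i ψ ⟧ k V Π j = Lift (lsuc 0ℓ) (G k j) × ⟦ ψ ⟧ k V Π (j +e i)
  ⟦ ψ ∨′ ψ′ ⟧  k V Π j = ⟦ ψ ⟧ k V Π j ⊎ ⟦ ψ′ ⟧ k V Π j
  ⟦ neg ψ ⟧    k V Π j = Lift (lsuc 0ℓ) (G k j) × ¬ ⟦ ψ ⟧ k V Π j
  ⟦ mu ψ ⟧     k V Π j =
    (ξ : PredVal _) →
    (∀ Π′ j′ → ξ Π′ j′ → G k j′) →
    (∀ Π′ j′ → ⟦ ψ ⟧ k (ξ ∷ V) Π′ j′ → ξ Π′ j′) →
    ξ Π j

  zeros : ∀ {n} → Fin n → ℕ
  zeros _ = 0

  _⊨[_]_ : ∀ {n} → Assign n → ℕ∞ → HForm nAP n → Set₁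
  Π ⊨[ k ] ex φ  = Σ (Path K) λ p → (p ∷ Π) ⊨[ k ] φ
  Π ⊨[ k ] all φ = (p : Path K) → (p ∷ Π) ⊨[ k ] φ
  Π ⊨[ k ] qf ψ  = Σ (Valuation _ 0) λ V → ⟦ ψ ⟧ k V Π zeros

_⊨_[_] : ∀ {nAP} → Kripke nAP → HForm nAP 0 → ℕ∞ → Set₁
K ⊨ φ [ k ] = Semantics._⊨[_]_ K [] k φ

-- Only the quantifier-free matrix depends on k; there monotonicity is proved
-- by induction on positive normal forms, for valuations V ⊆ V′ with V ⊆ G_k.
-- Atoms and ○ only need G_k ⊆ G_k′.  For μX.ψ, a pre-fixed point at k′ cut
-- down to G_k is a pre-fixed point at k.  For νX.ψ, encoded as
-- ¬μX.¬ψ[¬X/X], one shows classically (Knaster–Tarski) that every point of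
-- νX.ψ lies in a post-fixed point ζ ⊆ G_k of ψ; by induction ζ is still
-- post-fixed at k′, so by coinduction it lies in νX.ψ at k′.

module Submission where

open import Defs
open import Level using (Level; 0ℓ; _⊔_; lift; lower)
open import Data.Nat as ℕ using (ℕ)
open import Data.Nat.Properties using (≤-trans)
open import Data.Fin using (Fin; zero; suc; _≟_)
open import Data.Product using (Σ-syntax; _×_; _,_; proj₁; proj₂)
open import Data.Sum using (inj₁; inj₂)
open import Data.Unit using (tt)
open import Data.Vec.Functional using (_∷_; []; updateAt)
open import Data.Vec.Functional.Properties using (updateAt-updates; updateAt-minimal)
open import Function using (_∘_)
open import Relation.Nullary using (¬_; yes; no)
open import Relation.Nullary.Decidable using (map′)
open import Relation.Binary.PropositionalEquality using (_≡_; refl; sym; subst)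
open import Axiom.ExcludedMiddle using (ExcludedMiddle)
open import Axiom.DoubleNegationElimination using (DoubleNegationElimination; em⇒dne)

G-mono : ∀ {k k′} → k ≤∞ k′ → ∀ {n} {j : Fin n → ℕ} → G k j → G k′ j
G-mono (fin≤fin k≤k′) g i i′ = ≤-trans (g i i′) k≤k′
G-mono ≤∞-∞           _      = tt

module _ {nAP : ℕ} (K : Kripke nAP) where
  open Semantics K

  private
    variable
      a b c : Level
      n m : ℕ
      k : ℕ∞
      ξ ξ′ : PredVal n
      V V′ V″ : Valuation n m

  PointPred : ℕ → (a : Level) → Set (Level.suc a)
  PointPred n a = Assign n → (Fin n → ℕ) → Set a

  _⊆_ : PointPred n a → PointPred n b → Set (a ⊔ b)
  P ⊆ Q = ∀ Π j → P Π j → Q Π j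

  _≐_ : PointPred n a → PointPred n b → Set (a ⊔ b)
  P ≐ Q = P ⊆ Q × Q ⊆ P

  ⊆-refl : {P : PointPred n a} → P ⊆ P
  ⊆-refl _ _ p = p

  ≐-sym : {P : PointPred n a} {Q : PointPred n b} → P ≐ Q → Q ≐ P
  ≐-sym (P⊆Q , Q⊆P) = Q⊆P , P⊆Q

  ⊆-trans : {P : PointPred n a} {Q : PointPred n b} {R : PointPred n c} → P ⊆ Q → Q ⊆ R → P ⊆ R
  ⊆-trans P⊆Q Q⊆R Π j = Q⊆R Π j ∘ P⊆Q Π j

  Gₚ : ℕ∞ → PredVal n
  Gₚ k _ j = G k j

  ∁[_] : ℕ∞ → PredVal n → PredVal n
  ∁[ k ] ξ Π j = G k j × ¬ ξ Π j

  complementAt : ℕ∞ → Fin m → Valuation n m → Valuation n m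
  complementAt k x V = updateAt V x ∁[ k ]

  _⊆ᵛ_ : Valuation n m → Valuation n m → Set
  V ⊆ᵛ V′ = ∀ x → V x ⊆ V′ x

  _≋_ : Valuation n m → Valuation n m → Set
  V ≋ V′ = V ⊆ᵛ V′ × V′ ⊆ᵛ V

  Bounded : ℕ∞ → Valuation n m → Set
  Bounded k V = ∀ x → V x ⊆ Gₚ k

  ≋-refl : V ≋ V
  ≋-refl = (λ _ → ⊆-refl) , (λ _ → ⊆-refl)

  ≋-sym : V ≋ V′ → V′ ≋ V
  ≋-sym (V⊆V′ , V′⊆V) = V′⊆V , V⊆V′

  ≋-trans : V ≋ V′ → V′ ≋ V″ → V ≋ V″
  ≋-trans (V⊆V′ , V′⊆V) (V′⊆V″ , V″⊆V′) =
    (λ x → ⊆-trans (V⊆V′ x) (V′⊆V″ x)) , (λ x → ⊆-trans (V″⊆V′ x) (V′⊆V x))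

  ≡⇒⊆ : ξ ≡ ξ′ → ξ ⊆ ξ′
  ≡⇒⊆ ξ≡ξ′ Π j = subst (λ ζ → ζ Π j) ξ≡ξ′

  ≡⇒≋ : (∀ x → V x ≡ V′ x) → V ≋ V′
  ≡⇒≋ V≡V′ = (λ x → ≡⇒⊆ (V≡V′ x)) , (λ x → ≡⇒⊆ (sym (V≡V′ x)))

  ∷-mono : ξ ⊆ ξ′ → V ⊆ᵛ V′ → (ξ ∷ V) ⊆ᵛ (ξ′ ∷ V′)
  ∷-mono ξ⊆ξ′ V⊆V′ zero    = ξ⊆ξ′
  ∷-mono ξ⊆ξ′ V⊆V′ (suc x) = V⊆V′ x

  ∷-cong : ξ ≐ ξ′ → V ≋ V′ → (ξ ∷ V) ≋ (ξ′ ∷ V′)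
  ∷-cong (ξ⊆ξ′ , ξ′⊆ξ) (V⊆V′ , V′⊆V) = ∷-mono ξ⊆ξ′ V⊆V′ , ∷-mono ξ′⊆ξ V′⊆V

  ∷-bounded : ξ ⊆ Gₚ k → Bounded k V → Bounded k (ξ ∷ V)
  ∷-bounded ξ⊆G Vb zero    = ξ⊆G
  ∷-bounded ξ⊆G Vb (suc x) = Vb x

  complementAt-zero : complementAt k zero (ξ ∷ V) ≋ (∁[ k ] ξ ∷ V)
  complementAt-zero = ≡⇒≋ λ { zero → refl ; (suc _) → refl }

  complementAt-suc : ∀ x → complementAt k (suc x) (ξ ∷ V) ≋ (ξ ∷ complementAt k x V)
  complementAt-suc _ = ≡⇒≋ λ { zero → refl ; (suc _) → refl }

  ⟦mu⟧-mono : {ψ ψ′ : QF nAP n (ℕ.suc m)} →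
    (∀ ξ → ⟦ ψ ⟧ k (ξ ∷ V) ⊆ ⟦ ψ′ ⟧ k (ξ ∷ V′)) → ⟦ mu ψ ⟧ k V ⊆ ⟦ mu ψ′ ⟧ k V′
  ⟦mu⟧-mono ψ⊆ψ′ Π j μψ ξ ξ⊆G ψ′⊆ξ = μψ ξ ξ⊆G (⊆-trans (ψ⊆ψ′ ξ) ψ′⊆ξ)

  ⟦⟧-resp-≋ : (ψ : QF nAP n m) → V ≋ V′ → ⟦ ψ ⟧ k V ⊆ ⟦ ψ ⟧ k V′
  ⟦⟧-resp-≋ (atom a i)  V≋V′ Π j p                = p
  ⟦⟧-resp-≋ (var x)     V≋V′ Π j (lift p)         = lift (proj₁ V≋V′ x Π j p)
  ⟦⟧-resp-≋ (next i ψ)  V≋V′ Π j (g , p)          = g , ⟦⟧-resp-≋ ψ V≋V′ Π _ p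
  ⟦⟧-resp-≋ (ψ ∨′ ψ′)   V≋V′ Π j (inj₁ p)         = inj₁ (⟦⟧-resp-≋ ψ V≋V′ Π j p)
  ⟦⟧-resp-≋ (ψ ∨′ ψ′)   V≋V′ Π j (inj₂ p)         = inj₂ (⟦⟧-resp-≋ ψ′ V≋V′ Π j p)
  ⟦⟧-resp-≋ (neg ψ)     V≋V′ Π j (g , ¬p)         = g , ¬p ∘ ⟦⟧-resp-≋ ψ (≋-sym V≋V′) Π j
  ⟦⟧-resp-≋ (mu ψ)      V≋V′                      =
    ⟦mu⟧-mono λ ξ → ⟦⟧-resp-≋ ψ (∷-cong (⊆-refl , ⊆-refl) V≋V′)

  ⟦negAt⟧≐complementAt : ∀ (ψ : QF nAP n m) x V →
    ⟦ negAt x ψ ⟧ k V ≐ ⟦ ψ ⟧ k (complementAt k x V)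
  ⟦negAt⟧≐complementAt (atom a i) x V = ⊆-refl , ⊆-refl
  ⟦negAt⟧≐complementAt {k = k} (var y) x V with x ≟ y
  ... | yes refl =
    (λ { Π j (lift g , ¬v) → lift (≡⇒⊆ (sym x↦∁) Π j (g , ¬v ∘ lift)) }) ,
    (λ { Π j (lift v) → let g , ¬v = ≡⇒⊆ x↦∁ Π j v in lift g , ¬v ∘ lower })
    where x↦∁ = updateAt-updates x {∁[ k ]} V
  ... | no x≢y =
    (λ { Π j (lift v) → lift (≡⇒⊆ (sym y↦y) Π j v) }) ,
    (λ { Π j (lift v) → lift (≡⇒⊆ y↦y Π j v) })
    where y↦y = updateAt-minimal y x {∁[ k ]} V (x≢y ∘ sym)
  ⟦negAt⟧≐complementAt (next i ψ) x V =
    (λ { Π j (g , p) → g , proj₁ (⟦negAt⟧≐complementAt ψ x V) Π _ p }) ,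
    (λ { Π j (g , p) → g , proj₂ (⟦negAt⟧≐complementAt ψ x V) Π _ p })
  ⟦negAt⟧≐complementAt (ψ ∨′ ψ′) x V =
    (λ { Π j (inj₁ p) → inj₁ (proj₁ IH Π j p) ; Π j (inj₂ p) → inj₂ (proj₁ IH′ Π j p) }) ,
    (λ { Π j (inj₁ p) → inj₁ (proj₂ IH Π j p) ; Π j (inj₂ p) → inj₂ (proj₂ IH′ Π j p) })
    where IH  = ⟦negAt⟧≐complementAt ψ x V
          IH′ = ⟦negAt⟧≐complementAt ψ′ x V
  ⟦negAt⟧≐complementAt (neg ψ) x V =
    (λ { Π j (g , ¬p) → g , ¬p ∘ proj₂ IH Π j }) ,
    (λ { Π j (g , ¬p) → g , ¬p ∘ proj₁ IH Π j })
    where IH = ⟦negAt⟧≐complementAt ψ x V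
  ⟦negAt⟧≐complementAt (mu ψ) x V =
    ⟦mu⟧-mono (λ ξ → ⊆-trans (proj₁ (IH ξ)) (⟦⟧-resp-≋ ψ (complementAt-suc x))) ,
    ⟦mu⟧-mono (λ ξ → ⊆-trans (⟦⟧-resp-≋ ψ (≋-sym (complementAt-suc x))) (proj₂ (IH ξ)))
    where IH = λ ξ → ⟦negAt⟧≐complementAt ψ (suc x) (ξ ∷ V)

  ⟦⟧-bounded : (ψ : QF nAP n m) → Bounded k V → ⟦ ψ ⟧ k V ⊆ Gₚ k
  ⟦⟧-bounded (atom a i) Vb Π j (lift g , _) = g
  ⟦⟧-bounded (var x)    Vb Π j (lift v)     = Vb x Π j v
  ⟦⟧-bounded (next i ψ) Vb Π j (lift g , _) = g
  ⟦⟧-bounded (ψ ∨′ ψ′)  Vb Π j (inj₁ p)     = ⟦⟧-bounded ψ Vb Π j p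
  ⟦⟧-bounded (ψ ∨′ ψ′)  Vb Π j (inj₂ p)     = ⟦⟧-bounded ψ′ Vb Π j p
  ⟦⟧-bounded (neg ψ)    Vb Π j (lift g , _) = g
  ⟦⟧-bounded {k = k} (mu ψ) Vb Π j μψ =
    μψ (Gₚ k) ⊆-refl (⟦⟧-bounded ψ (∷-bounded ⊆-refl Vb))

  ⟦∧′⟧-intro : ∀ {ψ ψ′ : QF nAP n m} {Π j} →
    G k j → ⟦ ψ ⟧ k V Π j → ⟦ ψ′ ⟧ k V Π j → ⟦ ψ ∧′ ψ′ ⟧ k V Π j
  ⟦∧′⟧-intro g p p′ = lift g , λ { (inj₁ (_ , ¬p)) → ¬p p ; (inj₂ (_ , ¬p′)) → ¬p′ p′ }

  IsPostFixed : ℕ∞ → Valuation n m → QF nAP n (ℕ.suc m) → PredVal n → Set₁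
  IsPostFixed k V ψ ζ = ζ ⊆ Gₚ k × ζ ⊆ ⟦ ψ ⟧ k (ζ ∷ V)

  module Classical (em : ExcludedMiddle (Level.suc 0ℓ)) where

    dne₁ : DoubleNegationElimination (Level.suc 0ℓ)
    dne₁ = em⇒dne em

    dne₀ : DoubleNegationElimination 0ℓ
    dne₀ = em⇒dne (map′ lower lift em)

    ∁∁≐ : ξ ⊆ Gₚ k → ∁[ k ] (∁[ k ] ξ) ≐ ξ
    ∁∁≐ ξ⊆G = (λ { Π j (g , ¬¬ξ) → dne₀ (¬¬ξ ∘ (g ,_)) })
            , (λ Π j p → ξ⊆G Π j p , λ (_ , ¬p) → ¬p p)

    ⟦∧′⟧-elim : ∀ {ψ ψ′ : QF nAP n m} {Π j} →
      ⟦ ψ ∧′ ψ′ ⟧ k V Π j → ⟦ ψ ⟧ k V Π j × ⟦ ψ′ ⟧ k V Π j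
    ⟦∧′⟧-elim (lift g , ¬∨) =
      dne₁ (λ ¬p → ¬∨ (inj₁ (lift g , ¬p))) , dne₁ (λ ¬p′ → ¬∨ (inj₂ (lift g , ¬p′)))

    postFixed⊆⟦nu⟧ : ∀ (ψ : QF nAP n (ℕ.suc m)) {ζ} → IsPostFixed k V ψ ζ → ζ ⊆ ⟦ nu ψ ⟧ k V
    postFixed⊆⟦nu⟧ {k = k} {V = V} ψ {ζ} (ζ⊆G , ζ⊆ψ) Π j ζj =
      lift (ζ⊆G Π j ζj) , λ μ¬ψ → proj₂ (μ¬ψ (∁[ k ] ζ) (λ _ _ → proj₁) ∁ζ-preFixed) ζj
      where
      ∁ζ-preFixed : ⟦ neg (negAt zero ψ) ⟧ k (∁[ k ] ζ ∷ V) ⊆ ∁[ k ] ζ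
      ∁ζ-preFixed Π′ j′ (lift g , ¬ψ) = g , λ ζj′ →
        ¬ψ (proj₂ (⟦negAt⟧≐complementAt ψ zero (∁[ k ] ζ ∷ V)) Π′ j′
              (⟦⟧-resp-≋ ψ (≋-trans (∷-cong (≐-sym (∁∁≐ ζ⊆G)) ≋-refl)
                                     (≋-sym complementAt-zero))
                 Π′ j′ (ζ⊆ψ Π′ j′ ζj′)))

    ⟦nu⟧⇒postFixed : ∀ (ψ : QF nAP n (ℕ.suc m)) {Π j} →
      ⟦ nu ψ ⟧ k V Π j → Σ[ ζ ∈ PredVal n ] IsPostFixed k V ψ ζ × ζ Π j
    ⟦nu⟧⇒postFixed {k = k} {V = V} ψ (lift g , ¬μ¬ψ) = dne₁ λ ¬postFixed →
      ¬μ¬ψ λ ξ _ ξ-preFixed → dne₀ λ ¬ξj →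
        ¬postFixed (∁[ k ] ξ , ((λ _ _ → proj₁) , ∁ξ⊆ψ ξ-preFixed) , (g , ¬ξj))
      where
      ∁ξ⊆ψ : ∀ {ξ} → ⟦ neg (negAt zero ψ) ⟧ k (ξ ∷ V) ⊆ ξ → ∁[ k ] ξ ⊆ ⟦ ψ ⟧ k (∁[ k ] ξ ∷ V)
      ∁ξ⊆ψ {ξ} ξ-preFixed Π′ j′ (g′ , ¬ξj′) =
        ⟦⟧-resp-≋ ψ complementAt-zero Π′ j′
          (proj₁ (⟦negAt⟧≐complementAt ψ zero (ξ ∷ V)) Π′ j′
            (dne₁ λ ¬ψ → ¬ξj′ (ξ-preFixed Π′ j′ (lift g′ , ¬ψ))))

    module _ {k k′ : ℕ∞} (k≤k′ : k ≤∞ k′) where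

      ⟦⌊⌋⟧-mono : ∀ (ψ : PNF nAP n m) {V V′} → Bounded k V → V ⊆ᵛ V′ →
        ⟦ ⌊ ψ ⌋ ⟧ k V ⊆ ⟦ ⌊ ψ ⌋ ⟧ k′ V′
      ⟦⌊⌋⟧-mono (atom a i)  Vb V⊆V′ Π j (lift g , p)  = lift (G-mono k≤k′ g) , p
      ⟦⌊⌋⟧-mono (natom a i) Vb V⊆V′ Π j (lift g , ¬p) =
        lift (G-mono k≤k′ g) , λ (_ , p) → ¬p (lift g , p)
      ⟦⌊⌋⟧-mono (var x)     Vb V⊆V′ Π j (lift v)      = lift (V⊆V′ x Π j v)
      ⟦⌊⌋⟧-mono (next i ψ)  Vb V⊆V′ Π j (lift g , p)  =
        lift (G-mono k≤k′ g) , ⟦⌊⌋⟧-mono ψ Vb V⊆V′ Π _ p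
      ⟦⌊⌋⟧-mono (or ψ ψ′)   Vb V⊆V′ Π j (inj₁ p)      = inj₁ (⟦⌊⌋⟧-mono ψ Vb V⊆V′ Π j p)
      ⟦⌊⌋⟧-mono (or ψ ψ′)   Vb V⊆V′ Π j (inj₂ p)      = inj₂ (⟦⌊⌋⟧-mono ψ′ Vb V⊆V′ Π j p)
      ⟦⌊⌋⟧-mono (and ψ ψ′)  Vb V⊆V′ Π j ψ∧ψ′@(lift g , _) =
        let p , p′ = ⟦∧′⟧-elim ψ∧ψ′
        in ⟦∧′⟧-intro (G-mono k≤k′ g) (⟦⌊⌋⟧-mono ψ Vb V⊆V′ Π j p) (⟦⌊⌋⟧-mono ψ′ Vb V⊆V′ Π j p′)
      ⟦⌊⌋⟧-mono (μ′ ψ) {V} Vb V⊆V′ Π j μψ ξ′ _ ξ′-preFixed =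
        proj₁ (μψ ξ′∩G (λ _ _ → proj₂) ξ′∩G-preFixed)
        where
        ξ′∩G : PredVal _
        ξ′∩G Π j = ξ′ Π j × G k j
        ξ′∩G-preFixed : ⟦ ⌊ ψ ⌋ ⟧ k (ξ′∩G ∷ V) ⊆ ξ′∩G
        ξ′∩G-preFixed Π′ j′ p =
          ξ′-preFixed Π′ j′ (⟦⌊⌋⟧-mono ψ ξ′∩G∷Vb (∷-mono (λ _ _ → proj₁) V⊆V′) Π′ j′ p)
          , ⟦⟧-bounded ⌊ ψ ⌋ ξ′∩G∷Vb Π′ j′ p
          where ξ′∩G∷Vb = ∷-bounded (λ _ _ → proj₂) Vb
      ⟦⌊⌋⟧-mono (ν′ ψ) Vb V⊆V′ Π j νψ =
        let ζ , (ζ⊆G , ζ⊆ψ) , ζj = ⟦nu⟧⇒postFixed ⌊ ψ ⌋ νψ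
        in postFixed⊆⟦nu⟧ ⌊ ψ ⌋
             ( (λ Π′ j′ → G-mono k≤k′ ∘ ζ⊆G Π′ j′)
             , ⊆-trans ζ⊆ψ (⟦⌊⌋⟧-mono ψ (∷-bounded ζ⊆G Vb) (∷-mono ⊆-refl V⊆V′)) )
             Π j ζj

      ⊨-mono : ∀ (φ : HPNF nAP n) Π → Π ⊨[ k ] ⌊ φ ⌋H → Π ⊨[ k′ ] ⌊ φ ⌋H
      ⊨-mono (ex φ)  Π (p , Πp⊨φ) = p , ⊨-mono φ (p ∷ Π) Πp⊨φ
      ⊨-mono (all φ) Π Π⊨∀φ       = λ p → ⊨-mono φ (p ∷ Π) (Π⊨∀φ p)
      ⊨-mono (qf ψ)  Π (V , ψV)   = V , ⟦⌊⌋⟧-mono ψ (λ ()) (λ ()) Π zeros ψV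

corollary4p7 : ExcludedMiddle (Level.suc 0ℓ) →
    ∀ {nAP : ℕ} (K : Kripke nAP) (φ : HPNF nAP 0) (k k′ : ℕ∞) →
    k ≤∞ k′ → K ⊨ ⌊ φ ⌋H [ k ] → K ⊨ ⌊ φ ⌋H [ k′ ]
corollary4p7 em K φ k k′ k≤k′ = Classical.⊨-mono K em k≤k′ φ []
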